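{- There is a $\Delta_0$ such that the following holds for every $\Delta \ge \Delta_0$. Let $\epsilon = \frac{1}{8001}$, let $G$ be a $\Delta$-regular graph, let $d=4\lceil 20\epsilon\Delta\rceil$, and let $D_1,\dots,D_\ell,S$ be a $d$-dense decomposition of $G$. For every $D_i$ having a very suitable colouring, every very suitable colouring of $D_i$, and every set $J_i$ consisting of $\lceil 20\epsilon \Delta \rceil$ vertices lying in singleton colour classes of that colouring, and every subset $V'\subseteq V(G)\setminus D_i$: any proper $(\Delta+1-\lceil 20\epsilon \Delta\rceil)$-colouring of $G[V']$ can be extended to a proper $(\Delta+1-\lceil 20 \epsilon \Delta\rceil)$-colouring of $G[V' \cup (D_i\setminus J_i)]$.
   Context: A vertex $v$ of $G$ is $d$-sparse if $|E(G[N(v)])| < \binom{\Delta}{2}-d\Delta$. A $d$-dense decomposition of $G$ is a partition of $V(G)$ into sets $D_1,\dots,D_\ell$ and a set $S$ such that (a) every $D_i$ has between $\Delta+1-8d$ and $\Delta+4d$ vertices, (b) a vertex is adjacent to at least $\frac{3\Delta}{4}$ vertices of $D_i$ if and only if it is in $D_i$, and (c) every vertex of $S$ is $d$-sparse. A colouring of $D_i$ is suitable if: it is a proper colouring of $G[D_i]$ using at most $\Delta+1$ colours; the vertices forming singleton colour classes form a clique; no colour class has size exceeding three; and if there is a colour class of size three, then the number of colours used is $\Delta+1$ and every vertex in a colour class of size three is adjacent to every vertex forming a singleton colour class. A suitable colouring is very suitable if it has at least $\Delta-40\lceil 20\epsilon\Delta\rceil$ singleton colour classes. -}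

module Defs where

open import Data.Nat using (ℕ; zero; suc; _+_; _*_; _∸_; _≤_; _<_; _≥_)
open import Data.Nat.DivMod using (_/_)
open import Data.Nat.Combinatorics using (_C_)
open import Data.Fin using (Fin; zero; suc; toℕ)
open import Data.Fin.Properties using (_<?_)
open import Data.Fin.Subset using (Subset; _∈_; _∉_; _⊆_; _∩_; _∪_; _─_; ∁; ∣_∣)
open import Data.Fin.Subset.Properties using (_∈?_)
open import Data.Vec using (tabulate)
open import Data.Bool using (Bool; _∧_)
open import Data.Product using (Σ; ∃; ∃-syntax; _×_; _,_)
open import Data.Sum using (_⊎_)
open import Data.Empty using (⊥)
open import Relation.Nullary using (¬_; Dec; does)
open import Relation.Binary.PropositionalEquality using (_≡_; _≢_)
open import Relation.Binary using (Decidable)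

record Graph (n : ℕ) : Set₁ where
  field
    Adj    : Fin n → Fin n → Set
    adj?   : Decidable Adj
    sym    : ∀ {u v} → Adj u v → Adj v u
    irrefl : ∀ {v} → ¬ Adj v v

module _ {n : ℕ} (G : Graph n) where
  open Graph G

  N : Fin n → Subset n
  N v = tabulate (λ u → does (adj? v u))

  sumFin : ∀ {m} → (Fin m → ℕ) → ℕ
  sumFin {zero}  f = 0
  sumFin {suc m} f = f zero + sumFin (λ i → f (suc i))

  edgesIn : Subset n → ℕ
  edgesIn A = sumFin (λ u → ∣ tabulate (λ w →
      does (u <? w) ∧ does (adj? u w) ∧ does (u ∈? A) ∧ does (w ∈? A)) ∣)

  Regular : ℕ → Set
  Regular Δ = ∀ v → ∣ N v ∣ ≡ Δ

  -- v is d-sparse : |E(G[N(v)])| < (Δ choose 2) - dΔ   (stated without truncated subtraction)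
  Sparse : (Δ d : ℕ) → Fin n → Set
  Sparse Δ d v = edgesIn (N v) + d * Δ < Δ C 2

  record DenseDecomposition (Δ d : ℕ) : Set where
    field
      ℓ : ℕ
      D : Fin ℓ → Subset n
      S : Subset n
      cover     : ∀ v → v ∈ S ⊎ ∃[ i ] v ∈ D i
      disjDD    : ∀ i j v → v ∈ D i → v ∈ D j → i ≡ j
      disjDS    : ∀ i v → v ∈ D i → v ∉ S
      sizeLower : ∀ i → Δ + 1 ≤ ∣ D i ∣ + 8 * d
      sizeUpper : ∀ i → ∣ D i ∣ ≤ Δ + 4 * d
      adjIn     : ∀ i v → 3 * Δ ≤ 4 * ∣ N v ∩ D i ∣ → v ∈ D i
      inAdj     : ∀ i v → v ∈ D i → 3 * Δ ≤ 4 * ∣ N v ∩ D i ∣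
      sparseS   : ∀ v → v ∈ S → Sparse Δ d v

  ProperOn : ∀ {k} → Subset n → (Fin n → Fin k) → Set
  ProperOn A c = ∀ u v → u ∈ A → v ∈ A → Adj u v → c u ≢ c v

  colourClass : ∀ {k} → Subset n → (Fin n → Fin k) → Fin k → Subset n
  colourClass A c j = A ∩ tabulate (λ v → does (Data.Fin._≟_ (c v) j))

  numColours : ∀ {k} → Subset n → (Fin n → Fin k) → (ℕ → Bool) → ℕ
  numColours {k} A c P = ∣ tabulate (λ j → P ∣ colourClass A c j ∣) ∣

  isOne : ℕ → Bool
  isOne m = does (Data.Nat._≟_ m 1)

  isNonempty : ℕ → Bool
  isNonempty m = does (Data.Nat._≤?_ 1 m)

  InSingleton : ∀ {k} → Subset n → (Fin n → Fin k) → Fin n → Set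
  InSingleton A c v = v ∈ A × ∣ colourClass A c (c v) ∣ ≡ 1

  Suitable : (Δ : ℕ) → Subset n → (Fin n → Fin (suc Δ)) → Set
  Suitable Δ A c =
      ProperOn A c
    × (∀ u v → InSingleton A c u → InSingleton A c v → u ≢ v → Adj u v)
    × (∀ j → ∣ colourClass A c j ∣ ≤ 3)
    × ((∃[ j ] ∣ colourClass A c j ∣ ≡ 3) →
          numColours A c isNonempty ≡ suc Δ
        × (∀ u v → u ∈ A → ∣ colourClass A c (c u) ∣ ≡ 3 → InSingleton A c v → Adj u v))

-- ⌈ 20 ε Δ ⌉ with ε = 1/8001
ceil20ε : ℕ → ℕ
ceil20ε Δ = (20 * Δ + 8000) / 8001

module _ {n : ℕ} (G : Graph n) where
  VerySuitable : (Δ : ℕ) → Subset n → (Fin n → Fin (suc Δ)) → Set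
  VerySuitable Δ A c = Suitable G Δ A c × Δ ∸ 40 * ceil20ε Δ ≤ numColours G A c (isOne G)

{-# OPTIONS --safe #-}

-- Colour greedily in two layers, keeping J uncoloured. A vertex of Dᵢ in a non-singleton
-- class has at least 3Δ/4 neighbours inside Dᵢ, hence at most Δ/4 outside it, and there are
-- at most 56⌈20εΔ⌉ such vertices because a very suitable colouring has at least
-- Δ − 40⌈20εΔ⌉ singleton classes; so it sees fewer than Δ + 1 − ⌈20εΔ⌉ coloured vertices.
-- A singleton vertex outside J is adjacent to all of J (singletons form a clique), so it
-- sees at most Δ − ⌈20εΔ⌉ coloured vertices.
module Submission where

open import Defs
open import Data.Nat
  using (ℕ; suc; _+_; _*_; _∸_; _≤_; _<_; _≥_; z≤n; s≤s; z<s) renaming (_≟_ to _≟ℕ_)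
open import Data.Nat.Properties hiding (_≟_)
open import Data.Nat.DivMod using (m/n*n≤m)
open import Data.Nat.Tactic.RingSolver using (solve-∀)
open import Data.Fin using (Fin; zero; suc; _≟_)
open import Data.Fin.Subset
  using (Subset; inside; outside; _∈_; _∉_; _⊆_; _∩_; _∪_; _─_; ∁; ⁅_⁆; ⊥; ∣_∣; Nonempty)
open import Data.Fin.Subset.Properties
open import Data.List using (List; []; _∷_; filter; allFin)
open import Data.List.Membership.Propositional using () renaming (_∈_ to _∈ₗ_)
open import Data.List.Membership.Propositional.Properties using (∈-filter⁺; ∈-filter⁻; ∈-allFin)
open import Data.List.Relation.Unary.Any using (here; there)
open import Data.Vec using ([]; _∷_; tabulate; here; there)
open import Data.Vec.Properties using (lookup∘tabulate; lookup⇒[]=; []=⇒lookup)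
open import Data.Vec.Functional using (updateAt)
open import Data.Vec.Functional.Properties using (updateAt-updates; updateAt-minimal)
open import Data.Product using (∃-syntax; _×_; _,_; proj₁; proj₂)
open import Data.Sum using (inj₁; inj₂; [_,_]′)
open import Function using (_∘_; id; const)
open import Relation.Nullary using (yes; no; does; contradiction)
open import Relation.Nullary.Decidable using (dec-true)
open import Relation.Unary using (Pred; Decidable)
open import Relation.Binary.PropositionalEquality
  using (_≡_; _≢_; refl; sym; trans; cong; subst)

private
  variable
    n k : ℕ

∈-tabulate⁺ : ∀ {ℓ} {P : Pred (Fin n) ℓ} (P? : Decidable P) {x} → P x → x ∈ tabulate (does ∘ P?)
∈-tabulate⁺ P? {x} px = lookup⇒[]= x _ (trans (lookup∘tabulate (does ∘ P?) x) (dec-true (P? x) px))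

∈-tabulate⁻ : ∀ {ℓ} {P : Pred (Fin n) ℓ} (P? : Decidable P) {x} → x ∈ tabulate (does ∘ P?) → P x
∈-tabulate⁻ P? {x} x∈ with P? x | trans (sym (lookup∘tabulate (does ∘ P?) x)) ([]=⇒lookup x∈)
... | yes px | _  = px
... | no _   | ()

x∈p─q⁻ : ∀ (p q : Subset n) {x} → x ∈ p ─ q → x ∈ p × x ∉ q
x∈p─q⁻ (inside  ∷ p) (outside ∷ q) here       = here , λ ()
x∈p─q⁻ (inside  ∷ p) (inside  ∷ q) {zero} ()
x∈p─q⁻ (outside ∷ p) (outside ∷ q) {zero} ()
x∈p─q⁻ (outside ∷ p) (inside  ∷ q) {zero} ()
x∈p─q⁻ (_       ∷ p) (_       ∷ q) (there x∈) =
  there (proj₁ (x∈p─q⁻ p q x∈)) , proj₂ (x∈p─q⁻ p q x∈) ∘ drop-there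

x∈p∧x∉p─q⇒x∈q : ∀ {p q : Subset n} {x} → x ∈ p → x ∉ p ─ q → x ∈ q
x∈p∧x∉p─q⇒x∈q {q = q} {x} x∈p x∉p─q with x ∈? q
... | yes x∈q = x∈q
... | no  x∉q = contradiction (x∈p∧x∉q⇒x∈p─q x∈p x∉q) x∉p─q

∩-monoʳ-⊆ : ∀ {p q r : Subset n} → q ⊆ r → p ∩ q ⊆ p ∩ r
∩-monoʳ-⊆ {p = p} {q} q⊆r x∈ = let x∈p , x∈q = x∈p∩q⁻ p q x∈ in x∈p∩q⁺ (x∈p , q⊆r x∈q)

∪-monoˡ-⊆ : ∀ {p q r : Subset n} → p ⊆ q → p ∪ r ⊆ q ∪ r
∪-monoˡ-⊆ {p = p} {r = r} p⊆q x∈ = x∈p∪q⁺ ([ inj₁ ∘ p⊆q , inj₂ ]′ (x∈p∪q⁻ p r x∈))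

x∈p∪⁅y⁆∧x≢y⇒x∈p : ∀ {p : Subset n} {x y} → x ∈ p ∪ ⁅ y ⁆ → x ≢ y → x ∈ p
x∈p∪⁅y⁆∧x≢y⇒x∈p {p = p} {y = y} x∈ x≢y =
  [ id , (λ x∈⁅y⁆ → contradiction (x∈⁅y⁆⇒x≡y y x∈⁅y⁆) x≢y) ]′ (x∈p∪q⁻ p ⁅ y ⁆ x∈)

0<∣p∣⇒Nonempty : ∀ (p : Subset n) → 0 < ∣ p ∣ → Nonempty p
0<∣p∣⇒Nonempty (inside  ∷ p) _     = zero , here
0<∣p∣⇒Nonempty (outside ∷ p) 0<∣p∣ =
  let x , x∈p = 0<∣p∣⇒Nonempty p 0<∣p∣ in suc x , there x∈p

∣p∣<n⇒∃∉p : ∀ (p : Subset n) → ∣ p ∣ < n → ∃[ x ] x ∉ p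
∣p∣<n⇒∃∉p (outside ∷ p) _ = zero , λ ()
∣p∣<n⇒∃∉p (inside  ∷ p) (s≤s ∣p∣<n) =
  let x , x∉p = ∣p∣<n⇒∃∉p p ∣p∣<n in suc x , x∉p ∘ drop-there

∣p∪q∣≤∣p∣+∣q∣ : ∀ (p q : Subset n) → ∣ p ∪ q ∣ ≤ ∣ p ∣ + ∣ q ∣
∣p∪q∣≤∣p∣+∣q∣ []            []            = z≤n
∣p∪q∣≤∣p∣+∣q∣ (outside ∷ p) (outside ∷ q) = ∣p∪q∣≤∣p∣+∣q∣ p q
∣p∪q∣≤∣p∣+∣q∣ (outside ∷ p) (inside  ∷ q) =
  ≤-trans (s≤s (∣p∪q∣≤∣p∣+∣q∣ p q)) (≤-reflexive (sym (+-suc ∣ p ∣ ∣ q ∣)))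
∣p∪q∣≤∣p∣+∣q∣ (inside  ∷ p) (outside ∷ q) = s≤s (∣p∪q∣≤∣p∣+∣q∣ p q)
∣p∪q∣≤∣p∣+∣q∣ (inside  ∷ p) (inside  ∷ q) =
  s≤s (≤-trans (∣p∪q∣≤∣p∣+∣q∣ p q) (+-monoʳ-≤ ∣ p ∣ (n≤1+n ∣ q ∣)))

∣p─q∣+∣p∩q∣≡∣p∣ : ∀ (p q : Subset n) → ∣ p ─ q ∣ + ∣ p ∩ q ∣ ≡ ∣ p ∣
∣p─q∣+∣p∩q∣≡∣p∣ []            []            = refl
∣p─q∣+∣p∩q∣≡∣p∣ (outside ∷ p) (outside ∷ q) = ∣p─q∣+∣p∩q∣≡∣p∣ p q
∣p─q∣+∣p∩q∣≡∣p∣ (outside ∷ p) (inside  ∷ q) = ∣p─q∣+∣p∩q∣≡∣p∣ p q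
∣p─q∣+∣p∩q∣≡∣p∣ (inside  ∷ p) (outside ∷ q) = cong suc (∣p─q∣+∣p∩q∣≡∣p∣ p q)
∣p─q∣+∣p∩q∣≡∣p∣ (inside  ∷ p) (inside  ∷ q) =
  trans (+-suc ∣ p ─ q ∣ ∣ p ∩ q ∣) (cong suc (∣p─q∣+∣p∩q∣≡∣p∣ p q))

∣p∣+∣q∣≤∣r∣ : ∀ {p q r : Subset n} → p ⊆ r → q ⊆ r → (∀ {x} → x ∈ p → x ∉ q) →
              ∣ p ∣ + ∣ q ∣ ≤ ∣ r ∣
∣p∣+∣q∣≤∣r∣ {p = p} {q} {r} p⊆r q⊆r p∩q≡∅ = begin
  ∣ p ∣ + ∣ q ∣         ≤⟨ +-mono-≤ (p⊆q⇒∣p∣≤∣q∣ p⊆r─q) (p⊆q⇒∣p∣≤∣q∣ q⊆r∩q) ⟩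
  ∣ r ─ q ∣ + ∣ r ∩ q ∣ ≡⟨ ∣p─q∣+∣p∩q∣≡∣p∣ r q ⟩
  ∣ r ∣                 ∎
  where
  open ≤-Reasoning
  p⊆r─q : p ⊆ r ─ q
  p⊆r─q x∈p = x∈p∧x∉q⇒x∈p─q (p⊆r x∈p) (p∩q≡∅ x∈p)
  q⊆r∩q : q ⊆ r ∩ q
  q⊆r∩q x∈q = x∈p∩q⁺ (q⊆r x∈q , x∈q)

image : (Fin n → Fin k) → Subset n → Subset k
image f []            = ⊥
image f (inside  ∷ p) = ⁅ f zero ⁆ ∪ image (f ∘ suc) p
image f (outside ∷ p) = image (f ∘ suc) p

∈-image⁺ : ∀ (f : Fin n → Fin k) {p x} → x ∈ p → f x ∈ image f p
∈-image⁺ f {inside  ∷ p} here        = x∈p∪q⁺ (inj₁ (x∈⁅x⁆ (f zero)))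
∈-image⁺ f {inside  ∷ p} (there x∈p) = x∈p∪q⁺ (inj₂ (∈-image⁺ (f ∘ suc) x∈p))
∈-image⁺ f {outside ∷ p} (there x∈p) = ∈-image⁺ (f ∘ suc) x∈p

∣image∣≤∣p∣ : ∀ (f : Fin n → Fin k) p → ∣ image f p ∣ ≤ ∣ p ∣
∣image∣≤∣p∣ {k = k} f []    = ≤-reflexive (∣⊥∣≡0 k)
∣image∣≤∣p∣ f (outside ∷ p) = ∣image∣≤∣p∣ (f ∘ suc) p
∣image∣≤∣p∣ f (inside  ∷ p) = begin
  ∣ ⁅ f zero ⁆ ∪ image (f ∘ suc) p ∣      ≤⟨ ∣p∪q∣≤∣p∣+∣q∣ ⁅ f zero ⁆ _ ⟩
  ∣ ⁅ f zero ⁆ ∣ + ∣ image (f ∘ suc) p ∣  ≡⟨ cong (_+ ∣ image (f ∘ suc) p ∣) (∣⁅x⁆∣≡1 (f zero)) ⟩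
  suc ∣ image (f ∘ suc) p ∣               ≤⟨ s≤s (∣image∣≤∣p∣ (f ∘ suc) p) ⟩
  suc ∣ p ∣                               ∎
  where open ≤-Reasoning

infixl 6 _∪ₗ_

_∪ₗ_ : Subset n → List (Fin n) → Subset n
p ∪ₗ []       = p
p ∪ₗ (x ∷ xs) = (p ∪ₗ xs) ∪ ⁅ x ⁆

p⊆p∪ₗxs : ∀ {p : Subset n} xs → p ⊆ p ∪ₗ xs
p⊆p∪ₗxs []       = id
p⊆p∪ₗxs (x ∷ xs) = p⊆p∪q ⁅ x ⁆ ∘ p⊆p∪ₗxs xs

x∈ₗxs⇒x∈p∪ₗxs : ∀ {p : Subset n} {x xs} → x ∈ₗ xs → x ∈ p ∪ₗ xs
x∈ₗxs⇒x∈p∪ₗxs {p = p} {xs = x ∷ xs} (here refl) = q⊆p∪q (p ∪ₗ xs) ⁅ x ⁆ (x∈⁅x⁆ x)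
x∈ₗxs⇒x∈p∪ₗxs {xs = y ∷ xs}         (there x∈) = p⊆p∪q ⁅ y ⁆ (x∈ₗxs⇒x∈p∪ₗxs x∈)

p∪ₗxs⊆q : ∀ {p q : Subset n} xs → p ⊆ q → (∀ {x} → x ∈ₗ xs → x ∈ q) → p ∪ₗ xs ⊆ q
p∪ₗxs⊆q []       p⊆q xs⊆q = p⊆q
p∪ₗxs⊆q {p = p} (x ∷ xs) p⊆q xs⊆q y∈ with x∈p∪q⁻ (p ∪ₗ xs) ⁅ x ⁆ y∈
... | inj₁ y∈p∪ₗxs = p∪ₗxs⊆q xs p⊆q (xs⊆q ∘ there) y∈p∪ₗxs
... | inj₂ y∈⁅x⁆   = subst (_∈ _) (sym (x∈⁅y⁆⇒x≡y x y∈⁅x⁆)) (xs⊆q (here refl))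

module _ (G : Graph n) where
  open Graph G using (Adj; adj?; irrefl) renaming (sym to adj-sym)

  adj⇒∈N : ∀ {v u} → Adj v u → u ∈ N G v
  adj⇒∈N {v} = ∈-tabulate⁺ (adj? v)

  ProperOn-⊆ : ∀ {A B} {φ : Fin n → Fin k} → A ⊆ B → ProperOn G B φ → ProperOn G A φ
  ProperOn-⊆ A⊆B proper u v u∈A v∈A = proper u v (A⊆B u∈A) (A⊆B v∈A)

  ProperOn-∪⁅⁆ : ∀ {A w} {φ ψ : Fin n → Fin k} → ProperOn G A φ →
                 (∀ v → v ∈ A → Adj w v → φ v ≢ ψ w) → (∀ x → x ≢ w → ψ x ≡ φ x) →
                 ProperOn G (A ∪ ⁅ w ⁆) ψ
  ProperOn-∪⁅⁆ {w = w} proper avoids ψ≗φ u v u∈ v∈ uv with u ≟ w | v ≟ w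
  ... | yes refl | yes refl = contradiction uv irrefl
  ... | yes refl | no v≢w   = λ ψw≡ψv →
    avoids v (x∈p∪⁅y⁆∧x≢y⇒x∈p v∈ v≢w) uv (trans (sym (ψ≗φ v v≢w)) (sym ψw≡ψv))
  ... | no u≢w   | yes refl = λ ψu≡ψw →
    avoids u (x∈p∪⁅y⁆∧x≢y⇒x∈p u∈ u≢w) (adj-sym uv) (trans (sym (ψ≗φ u u≢w)) ψu≡ψw)
  ... | no u≢w   | no v≢w   = λ ψu≡ψv →
    proper u v (x∈p∪⁅y⁆∧x≢y⇒x∈p u∈ u≢w) (x∈p∪⁅y⁆∧x≢y⇒x∈p v∈ v≢w) uv
      (trans (sym (ψ≗φ u u≢w)) (trans ψu≡ψv (ψ≗φ v v≢w)))

  extendByVertex : ∀ {A w} {φ : Fin n → Fin k} → ProperOn G A φ → ∣ N G w ∩ A ∣ < k →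
                   ∃[ ψ ] ProperOn G (A ∪ ⁅ w ⁆) ψ × (∀ x → x ≢ w → ψ x ≡ φ x)
  extendByVertex {A = A} {w} {φ} proper few
    with j , j∉used ← ∣p∣<n⇒∃∉p (image φ (N G w ∩ A)) (≤-<-trans (∣image∣≤∣p∣ φ (N G w ∩ A)) few)
    = ψ , ProperOn-∪⁅⁆ proper avoids ψ≗φ , ψ≗φ
    where
    ψ : Fin n → Fin _
    ψ = updateAt φ w (const j)
    ψ≗φ : ∀ x → x ≢ w → ψ x ≡ φ x
    ψ≗φ x x≢w = updateAt-minimal x w φ x≢w
    avoids : ∀ v → v ∈ A → Adj w v → φ v ≢ ψ w
    avoids v v∈A wv φv≡ψw = j∉used (subst (_∈ image φ (N G w ∩ A))
      (trans φv≡ψw (updateAt-updates w φ)) (∈-image⁺ φ (x∈p∩q⁺ (adj⇒∈N wv , v∈A))))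

  extendAlong : ∀ {V B} {φ : Fin n → Fin k} → ProperOn G V φ → V ⊆ B → ∀ xs →
                (∀ {w} → w ∈ₗ xs → w ∈ B × w ∉ V × ∣ N G w ∩ B ∣ < k) →
                ∃[ ψ ] ProperOn G (V ∪ₗ xs) ψ × (∀ v → v ∈ V → ψ v ≡ φ v)
  extendAlong {φ = φ} proper V⊆B [] _ = φ , proper , λ _ _ → refl
  extendAlong {V = V} {B} proper V⊆B (w ∷ xs) pending =
    let ψ , ψ-proper , ψ≗φ    = extendAlong proper V⊆B xs (pending ∘ there)
        _ , w∉V , few         = pending (here refl)
        ψ′ , ψ′-proper , ψ′≗ψ = extendByVertex {w = w} ψ-proper
                                  (≤-<-trans (p⊆q⇒∣p∣≤∣q∣ N∩[V∪ₗxs]⊆N∩B) few)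
    in  ψ′ , ψ′-proper , λ v v∈V → trans (ψ′≗ψ v (λ { refl → w∉V v∈V })) (ψ≗φ v v∈V)
    where
    N∩[V∪ₗxs]⊆N∩B : N G w ∩ (V ∪ₗ xs) ⊆ N G w ∩ B
    N∩[V∪ₗxs]⊆N∩B = ∩-monoʳ-⊆ (p∪ₗxs⊆q xs V⊆B (proj₁ ∘ pending ∘ there))

  greedyExtension : ∀ V W (φ : Fin n → Fin k) → ProperOn G V φ →
                    (∀ w → w ∈ W → w ∉ V → ∣ N G w ∩ (V ∪ W) ∣ < k) →
                    ∃[ ψ ] ProperOn G (V ∪ W) ψ × (∀ v → v ∈ V → ψ v ≡ φ v)
  greedyExtension {k = k} V W φ proper few =
    let ψ , ψ-proper , ψ≗φ = extendAlong proper (p⊆p∪q W) pending pending-ok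
    in  ψ , ProperOn-⊆ V∪W⊆V∪ₗpending ψ-proper , ψ≗φ
    where
    pending : List (Fin n)
    pending = filter (_∈? W ─ V) (allFin n)
    pending-ok : ∀ {w} → w ∈ₗ pending → w ∈ V ∪ W × w ∉ V × ∣ N G w ∩ (V ∪ W) ∣ < k
    pending-ok w∈ₗ =
      let w∈W , w∉V = x∈p─q⁻ W V (proj₂ (∈-filter⁻ (_∈? W ─ V) {xs = allFin n} w∈ₗ))
      in  q⊆p∪q V W w∈W , w∉V , few _ w∈W w∉V
    V∪W⊆V∪ₗpending : V ∪ W ⊆ V ∪ₗ pending
    V∪W⊆V∪ₗpending {x} x∈ with x ∈? V
    ... | yes x∈V = p⊆p∪ₗxs pending x∈V
    ... | no  x∉V = x∈ₗxs⇒x∈p∪ₗxs (∈-filter⁺ (_∈? W ─ V) (∈-allFin x) (x∈p∧x∉q⇒x∈p─q x∈W x∉V))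
      where
      x∈W : x ∈ W
      x∈W = [ (λ x∈V → contradiction x∈V x∉V) , id ]′ (x∈p∪q⁻ V W x∈)

  4∣N─D∣≤Δ : ∀ {Δ u D} → Regular G Δ → 3 * Δ ≤ 4 * ∣ N G u ∩ D ∣ → 4 * ∣ N G u ─ D ∣ ≤ Δ
  4∣N─D∣≤Δ {Δ} {u} {D} regular 3Δ≤4b = +-cancelʳ-≤ (3 * Δ) (4 * a) Δ (begin
    4 * a + 3 * Δ ≤⟨ +-monoʳ-≤ (4 * a) 3Δ≤4b ⟩
    4 * a + 4 * b ≡⟨ sym (*-distribˡ-+ 4 a b) ⟩
    4 * (a + b)   ≡⟨ cong (4 *_) (trans (∣p─q∣+∣p∩q∣≡∣p∣ (N G u) D) (regular u)) ⟩
    Δ + 3 * Δ     ∎)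
    where
    open ≤-Reasoning
    a = ∣ N G u ─ D ∣
    b = ∣ N G u ∩ D ∣

m+n≤o⇒m<1+o∸n : ∀ {m n o} → m + n ≤ o → m < suc o ∸ n
m+n≤o⇒m<1+o∸n {m} m+n≤o = m+n≤o⇒m≤o∸n (suc m) (s≤s m+n≤o)

-- 228 = 4 · 56 + 4, see nonSingletonLayer-few-neighbours.
228⌈20εΔ⌉≤3Δ : ∀ {Δ} → 100 ≤ Δ → 228 * ceil20ε Δ ≤ 3 * Δ
228⌈20εΔ⌉≤3Δ {Δ} 100≤Δ = *-cancelʳ-≤ (228 * ⌈20εΔ⌉) (3 * Δ) 8001 (begin
  228 * ⌈20εΔ⌉ * 8001    ≡⟨ *-assoc 228 ⌈20εΔ⌉ 8001 ⟩
  228 * (⌈20εΔ⌉ * 8001)  ≤⟨ *-monoʳ-≤ 228 (m/n*n≤m (20 * Δ + 8000) 8001) ⟩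
  228 * (20 * Δ + 8000)  ≡⟨ expand Δ ⟩
  4560 * Δ + 1824000     ≤⟨ +-monoʳ-≤ (4560 * Δ) 1824000≤19443Δ ⟩
  4560 * Δ + 19443 * Δ   ≡⟨ collect Δ ⟩
  3 * Δ * 8001           ∎)
  where
  open ≤-Reasoning
  ⌈20εΔ⌉ = ceil20ε Δ
  1824000≤19443Δ : 1824000 ≤ 19443 * Δ
  1824000≤19443Δ = ≤-trans (m≤n+m 1824000 120300) (*-monoʳ-≤ 19443 100≤Δ)
  expand : ∀ Δ → 228 * (20 * Δ + 8000) ≡ 4560 * Δ + 1824000
  expand = solve-∀
  collect : ∀ Δ → 4560 * Δ + 19443 * Δ ≡ 3 * Δ * 8001
  collect = solve-∀

module _ (G : Graph n) (A : Subset n) (c : Fin n → Fin k) where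

  singletons : Subset n
  singletons = A ∩ tabulate (λ v → isOne G ∣ colourClass G A c (c v) ∣)

  ∈-singletons⁺ : ∀ {v} → InSingleton G A c v → v ∈ singletons
  ∈-singletons⁺ (v∈A , singleton) =
    x∈p∩q⁺ (v∈A , ∈-tabulate⁺ (λ v → ∣ colourClass G A c (c v) ∣ ≟ℕ 1) singleton)

  ∈-singletons⁻ : ∀ {v} → v ∈ singletons → InSingleton G A c v
  ∈-singletons⁻ v∈ =
    let v∈A , singleton = x∈p∩q⁻ A _ v∈
    in  v∈A , ∈-tabulate⁻ (λ v → ∣ colourClass G A c (c v) ∣ ≟ℕ 1) singleton

  ∈-colourClass⁻ : ∀ {u j} → u ∈ colourClass G A c j → u ∈ A × c u ≡ j
  ∈-colourClass⁻ {j = j} u∈ =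
    let u∈A , cu≡j = x∈p∩q⁻ A _ u∈ in u∈A , ∈-tabulate⁻ (λ v → c v ≟ j) cu≡j

  numColours-isOne≤∣singletons∣ : numColours G A c (isOne G) ≤ ∣ singletons ∣
  numColours-isOne≤∣singletons∣ =
    ≤-trans (p⊆q⇒∣p∣≤∣q∣ singletonColours⊆image) (∣image∣≤∣p∣ c singletons)
    where
    singletonColours⊆image : tabulate (λ j → isOne G ∣ colourClass G A c j ∣) ⊆ image c singletons
    singletonColours⊆image {j} j∈ =
      let singleton = ∈-tabulate⁻ (λ j → ∣ colourClass G A c j ∣ ≟ℕ 1) j∈
          u , u∈class = 0<∣p∣⇒Nonempty (colourClass G A c j) (subst (0 <_) (sym singleton) z<s)
          u∈A , cu≡j = ∈-colourClass⁻ u∈class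
          u-singleton = subst (λ j → ∣ colourClass G A c j ∣ ≡ 1) (sym cu≡j) singleton
      in  subst (_∈ image c singletons) cu≡j (∈-image⁺ c (∈-singletons⁺ (u∈A , u-singleton)))

  singletonLayer-few-neighbours :
    ∀ {Δ d J V w} → Regular G Δ →
    (∀ u v → InSingleton G A c u → InSingleton G A c v → u ≢ v → Graph.Adj G u v) →
    ∣ J ∣ ≡ d → (∀ v → v ∈ J → InSingleton G A c v) → V ⊆ ∁ A →
    w ∈ A ─ J → w ∉ V ∪ (A ─ singletons) →
    ∣ N G w ∩ ((V ∪ (A ─ singletons)) ∪ (A ─ J)) ∣ < suc Δ ∸ d
  singletonLayer-few-neighbours {Δ} {J = J} {V} {w}
                                regular clique refl J-singletons V⊆∁A w∈A─J w∉V∪M =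
    m+n≤o⇒m<1+o∸n (subst (∣ N G w ∩ B ∣ + ∣ J ∣ ≤_) (regular w)
                      (∣p∣+∣q∣≤∣r∣ (p∩q⊆p (N G w) B) J⊆N B∩J≡∅))
    where
    B = (V ∪ (A ─ singletons)) ∪ (A ─ J)
    w∈A = proj₁ (x∈p─q⁻ A J w∈A─J)
    w-singleton : InSingleton G A c w
    w-singleton = ∈-singletons⁻ (x∈p∧x∉p─q⇒x∈q w∈A (w∉V∪M ∘ q⊆p∪q V _))
    J⊆N : J ⊆ N G w
    J⊆N {y} y∈J = adj⇒∈N G (clique w y w-singleton (J-singletons y y∈J)
                    λ { refl → proj₂ (x∈p─q⁻ A J w∈A─J) y∈J })
    B∩J≡∅ : ∀ {x} → x ∈ N G w ∩ B → x ∉ J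
    B∩J≡∅ {x} x∈ x∈J with x∈p∪q⁻ _ (A ─ J) (proj₂ (x∈p∩q⁻ (N G w) B x∈))
    ... | inj₂ x∈A─J = proj₂ (x∈p─q⁻ A J x∈A─J) x∈J
    ... | inj₁ x∈V∪M with x∈p∪q⁻ V (A ─ singletons) x∈V∪M
    ...   | inj₁ x∈V = x∈∁p⇒x∉p (V⊆∁A x∈V) (proj₁ (J-singletons x x∈J))
    ...   | inj₂ x∈M = proj₂ (x∈p─q⁻ A singletons x∈M) (∈-singletons⁺ (J-singletons x x∈J))

module _ {G : Graph n} {Δ} (regular : Regular G Δ) (dec : DenseDecomposition G Δ (4 * ceil20ε Δ))
         (i : Fin (DenseDecomposition.ℓ dec)) (c : Fin n → Fin (suc Δ))
         (manySingletons :
            Δ ∸ 40 * ceil20ε Δ ≤ numColours G (DenseDecomposition.D dec i) c (isOne G))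
         where
  open DenseDecomposition dec using (D; sizeUpper; inAdj)

  ∣nonSingletons∣≤56⌈20εΔ⌉ : ∣ D i ─ singletons G (D i) c ∣ ≤ 56 * ceil20ε Δ
  ∣nonSingletons∣≤56⌈20εΔ⌉ = +-cancelʳ-≤ s m (56 * ⌈20εΔ⌉) (begin
    m + s                                   ≤⟨ ∣p∣+∣q∣≤∣r∣ (p─q⊆p (D i) S) (p∩q⊆p (D i) _) M∩S≡∅ ⟩
    ∣ D i ∣                                 ≤⟨ sizeUpper i ⟩
    Δ + 16⌈20εΔ⌉                            ≤⟨ +-monoˡ-≤ 16⌈20εΔ⌉ (m≤n+m∸n Δ 40⌈20εΔ⌉) ⟩
    40⌈20εΔ⌉ + (Δ ∸ 40⌈20εΔ⌉) + 16⌈20εΔ⌉   ≤⟨ +-monoˡ-≤ 16⌈20εΔ⌉ (+-monoʳ-≤ 40⌈20εΔ⌉ many) ⟩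
    40⌈20εΔ⌉ + s + 16⌈20εΔ⌉                 ≡⟨ collect ⌈20εΔ⌉ s ⟩
    56 * ⌈20εΔ⌉ + s                         ∎)
    where
    open ≤-Reasoning
    ⌈20εΔ⌉ = ceil20ε Δ
    16⌈20εΔ⌉ = 4 * (4 * ⌈20εΔ⌉)
    40⌈20εΔ⌉ = 40 * ⌈20εΔ⌉
    S = singletons G (D i) c
    m = ∣ D i ─ S ∣
    s = ∣ S ∣
    M∩S≡∅ : ∀ {x} → x ∈ D i ─ S → x ∉ S
    M∩S≡∅ x∈ = proj₂ (x∈p─q⁻ (D i) S x∈)
    many : Δ ∸ 40⌈20εΔ⌉ ≤ s
    many = ≤-trans manySingletons (numColours-isOne≤∣singletons∣ G (D i) c)
    collect : ∀ c s → 40 * c + s + 4 * (4 * c) ≡ 56 * c + s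
    collect = solve-∀

  nonSingletonLayer-few-neighbours :
    100 ≤ Δ → ∀ {V u} → V ⊆ ∁ (D i) → u ∈ D i ─ singletons G (D i) c →
    ∣ N G u ∩ (V ∪ (D i ─ singletons G (D i) c)) ∣ < suc Δ ∸ ceil20ε Δ
  nonSingletonLayer-few-neighbours 100≤Δ {V} {u} V⊆∁Dᵢ u∈M =
    m+n≤o⇒m<1+o∸n (*-cancelˡ-≤ 4 (begin
      4 * (x + ⌈20εΔ⌉)                     ≤⟨ *-monoʳ-≤ 4 (+-monoˡ-≤ ⌈20εΔ⌉ x≤a+m) ⟩
      4 * (a + m + ⌈20εΔ⌉)                 ≡⟨ distribute a m ⌈20εΔ⌉ ⟩
      4 * a + 4 * m + 4 * ⌈20εΔ⌉           ≤⟨ +-monoˡ-≤ (4 * ⌈20εΔ⌉) (+-mono-≤ 4a≤Δ 4m≤224⌈20εΔ⌉) ⟩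
      Δ + 4 * (56 * ⌈20εΔ⌉) + 4 * ⌈20εΔ⌉   ≡⟨ collect Δ ⌈20εΔ⌉ ⟩
      Δ + 228 * ⌈20εΔ⌉                     ≤⟨ +-monoʳ-≤ Δ (228⌈20εΔ⌉≤3Δ 100≤Δ) ⟩
      Δ + 3 * Δ                            ∎))
    where
    open ≤-Reasoning
    ⌈20εΔ⌉ = ceil20ε Δ
    M = D i ─ singletons G (D i) c
    x = ∣ N G u ∩ (V ∪ M) ∣
    a = ∣ N G u ─ D i ∣
    m = ∣ M ∣
    N∩[V∪M]⊆[N─Dᵢ]∪M : N G u ∩ (V ∪ M) ⊆ (N G u ─ D i) ∪ M
    N∩[V∪M]⊆[N─Dᵢ]∪M {y} y∈ with x∈p∩q⁻ (N G u) (V ∪ M) y∈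
    ... | y∈N , y∈V∪M = x∈p∪q⁺ ([ inj₁ ∘ y∈V⇒y∈N─Dᵢ , inj₂ ]′ (x∈p∪q⁻ V M y∈V∪M))
      where
      y∈V⇒y∈N─Dᵢ : y ∈ V → y ∈ N G u ─ D i
      y∈V⇒y∈N─Dᵢ y∈V = x∈p∧x∉q⇒x∈p─q y∈N (x∈∁p⇒x∉p (V⊆∁Dᵢ y∈V))
    x≤a+m : x ≤ a + m
    x≤a+m = ≤-trans (p⊆q⇒∣p∣≤∣q∣ N∩[V∪M]⊆[N─Dᵢ]∪M) (∣p∪q∣≤∣p∣+∣q∣ (N G u ─ D i) M)
    4a≤Δ : 4 * a ≤ Δ
    4a≤Δ = 4∣N─D∣≤Δ G regular (inAdj i u (proj₁ (x∈p─q⁻ (D i) _ u∈M)))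
    4m≤224⌈20εΔ⌉ : 4 * m ≤ 4 * (56 * ⌈20εΔ⌉)
    4m≤224⌈20εΔ⌉ = *-monoʳ-≤ 4 ∣nonSingletons∣≤56⌈20εΔ⌉
    distribute : ∀ a m c → 4 * (a + m + c) ≡ 4 * a + 4 * m + 4 * c
    distribute = solve-∀
    collect : ∀ Δ c → Δ + 4 * (56 * c) + 4 * c ≡ Δ + 228 * c
    collect = solve-∀

lemma16 : ∃[ Δ₀ ] ∀ (Δ : ℕ) → Δ ≥ Δ₀ →
    ∀ {n} (G : Graph n) → Regular G Δ →
    (dec : DenseDecomposition G Δ (4 * ceil20ε Δ)) →
    (i : Fin (DenseDecomposition.ℓ dec)) →
    let Di = DenseDecomposition.D dec i in
    (c : Fin n → Fin (suc Δ)) → VerySuitable G Δ Di c →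
    (J : Subset n) → ∣ J ∣ ≡ ceil20ε Δ → (∀ v → v ∈ J → InSingleton G Di c v) →
    (V' : Subset n) → V' ⊆ ∁ Di →
    (φ : Fin n → Fin (suc Δ ∸ ceil20ε Δ)) → ProperOn G V' φ →
    ∃[ ψ ] (ProperOn G (V' ∪ (Di ─ J)) ψ × (∀ v → v ∈ V' → ψ v ≡ φ v))
lemma16 = 100 , λ Δ 100≤Δ G regular dec i c ((_ , clique , _) , manySingletons)
                  J ∣J∣≡⌈20εΔ⌉ J-singletons V' V'⊆∁Dᵢ φ φ-proper →
  let Dᵢ = DenseDecomposition.D dec i
      M  = Dᵢ ─ singletons G Dᵢ c
      ψ₁ , ψ₁-proper , ψ₁≗φ = greedyExtension G V' M φ φ-proper λ u u∈M _ →
        nonSingletonLayer-few-neighbours regular dec i c manySingletons 100≤Δ V'⊆∁Dᵢ u∈M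
      ψ₂ , ψ₂-proper , ψ₂≗ψ₁ = greedyExtension G (V' ∪ M) (Dᵢ ─ J) ψ₁ ψ₁-proper λ w w∈Dᵢ─J w∉V'∪M →
        singletonLayer-few-neighbours G Dᵢ c regular clique ∣J∣≡⌈20εΔ⌉ J-singletons V'⊆∁Dᵢ
          w∈Dᵢ─J w∉V'∪M
  in  ψ₂ , ProperOn-⊆ G (∪-monoˡ-⊆ (p⊆p∪q M)) ψ₂-proper ,
      λ v v∈V' → trans (ψ₂≗ψ₁ v (p⊆p∪q M v∈V')) (ψ₁≗φ v v∈V')
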